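{- Let $k\ge2$ and let $\mathcal H$ be a $k$-uniform multi-hypergraph without isolated vertices, and let $R$ be a rooting of $\mathcal H$ that is an Euler rooting. Then $\mathcal H$ is a Veblen hypergraph, and $\mathcal H$ is the only labeled multi-hypergraph without isolated vertices of which $R$ is a rooting.
   Context: A $k$-uniform multi-hypergraph may have repeated edges. A Veblen hypergraph is a $k$-uniform multi-hypergraph in which every vertex degree (counted with multiplicity) is divisible by $k$. For a $k$-set $e$ and $u\in e$, the $u$-rooted directed star $S_e(u)$ is the digraph with arcs $uv$, $v\in e\setminus\{u\}$. A rooting of $\mathcal H$ (vertices labeled by integers) is a sequence $R=((e_1,v_1),\dots,(e_m,v_m))$ with the multiset $\{e_1,\dots,e_m\}$ equal to the edge multiset of $\mathcal H$, $v_i\in e_i$, and $v_1\le\dots\le v_m$; $D_R=\bigcup_iS_{e_i}(v_i)$ with arc multiplicities added. $R$ is an Euler rooting if $D_R$ is Eulerian (weakly connected, in-degree equal to out-degree at every vertex). -}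

module Defs where

open import Data.Nat using (ℕ; _≤_; _>_)
open import Data.Nat.Divisibility using (_∣_)
open import Data.Bool using (Bool; _∧_; not)
open import Data.Fin using (Fin) renaming (_≤_ to _≤ᶠ_)
open import Data.Fin.Properties using (_≟_)
open import Data.Fin.Subset using (Subset; _∈_; _⊆_; ∣_∣)
open import Data.Fin.Subset.Properties using (_∈?_)
open import Data.List using (List; length; filterᵇ; map; allFin)
open import Data.Nat.ListAction using (sum)
open import Data.List.Relation.Unary.All using (All)
open import Data.List.Relation.Unary.Any using (Any)
open import Data.List.Relation.Unary.Linked using (Linked)
open import Data.List.Relation.Binary.Permutation.Propositional using (_↭_)
open import Data.Product using (Σ; _×_; _,_; proj₁; proj₂; ∃)
open import Data.Sum using (_⊎_)
open import Relation.Nullary using (¬_)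
open import Relation.Nullary.Decidable using (⌊_⌋)
open import Relation.Binary.PropositionalEquality using (_≡_)
open import Relation.Binary.Construct.Closure.ReflexiveTransitive using (Star)

-- A labeled multi-hypergraph whose vertex labels lie in the ambient label set Fin n.
-- V is the vertex set, E the edge multiset (a list, compared up to permutation);
-- each edge is a subset of V.
record MultiHypergraph (n : ℕ) : Set where
  field
    V   : Subset n
    E   : List (Subset n)
    E⊆V : All (_⊆ V) E
open MultiHypergraph public

Uniform : ∀ {n} → ℕ → MultiHypergraph n → Set
Uniform k H = All (λ e → ∣ e ∣ ≡ k) (E H)

NoIsolatedVertices : ∀ {n} → MultiHypergraph n → Set
NoIsolatedVertices H = ∀ v → v ∈ V H → Any (v ∈_) (E H)

degree : ∀ {n} → MultiHypergraph n → Fin n → ℕ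
degree H v = length (filterᵇ (λ e → ⌊ v ∈? e ⌋) (E H))

Veblen : ∀ {n} → ℕ → MultiHypergraph n → Set
Veblen k H = Uniform k H × (∀ v → v ∈ V H → k ∣ degree H v)

RootSeq : ℕ → Set
RootSeq n = List (Subset n × Fin n)

IsRooting : ∀ {n} → MultiHypergraph n → RootSeq n → Set
IsRooting H R =
  (map proj₁ R ↭ E H)
  × All (λ p → proj₂ p ∈ proj₁ p) R
  × Linked (λ p q → proj₂ p ≤ᶠ proj₂ q) R

-- D_R = union of the rooted stars S_{e_i}(v_i) with multiplicities added:
-- multiplicity of the arc u → v
arcMult : ∀ {n} → RootSeq n → Fin n → Fin n → ℕ
arcMult R u v =
  length (filterᵇ (λ p → ⌊ proj₂ p ≟ u ⌋ ∧ (⌊ v ∈? proj₁ p ⌋ ∧ not ⌊ v ≟ u ⌋)) R)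

outDeg inDeg : ∀ {n} → RootSeq n → Fin n → ℕ
outDeg {n} R w = sum (map (arcMult R w) (allFin n))
inDeg  {n} R w = sum (map (λ u → arcMult R u w) (allFin n))

-- vertex set of D_R: the union of the edges e_i (vertex sets of the stars)
InD : ∀ {n} → RootSeq n → Fin n → Set
InD R x = Any (λ p → x ∈ proj₁ p) R

Adj : ∀ {n} → RootSeq n → Fin n → Fin n → Set
Adj R x y = (arcMult R x y > 0) ⊎ (arcMult R y x > 0)

WeaklyConnected : ∀ {n} → RootSeq n → Set
WeaklyConnected R = ∀ x y → InD R x → InD R y → Star (Adj R) x y

Eulerian : ∀ {n} → RootSeq n → Set
Eulerian R = WeaklyConnected R × (∀ w → inDeg R w ≡ outDeg R w)

IsEulerRooting : ∀ {n} → MultiHypergraph n → RootSeq n → Set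
IsEulerRooting H R = IsRooting H R × Eulerian R

SameHypergraph : ∀ {n} → MultiHypergraph n → MultiHypergraph n → Set
SameHypergraph H H' = (V H ≡ V H') × (E H ↭ E H')

module Submission where

-- For a vertex w let ρ(w) be the number of edges rooted at w.  An edge through w rooted at w
-- adds k − 1 to the out-degree of w in D_R and nothing to its in-degree; an edge through w
-- rooted elsewhere adds exactly one in-arc.  Hence in(w) + ρ(w) = deg(w) and
-- out(w) + ρ(w) = k ρ(w), and in(w) = out(w) gives deg(w) = k ρ(w).  Uniqueness holds because
-- a rooting fixes the edge multiset, and without isolated vertices the vertex set is the union
-- of the edges.

open import Defs
open import Data.Bool using (Bool; true; false; _∧_; not; T?)
open import Data.Fin using (Fin; zero; suc)
open import Data.Fin.Properties using (_≟_)
open import Data.Fin.Subset using (Subset; _∈_; _⊆_; ∣_∣; inside; outside)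
open import Data.Fin.Subset.Properties using (_∈?_; ⊆-antisym)
open import Data.Vec using ([]; _∷_)
open import Data.List using (List; []; _∷_; length; filterᵇ; map; allFin)
open import Data.List.Properties using (map-cong; map-tabulate)
open import Data.List.Relation.Unary.All using (All; []; _∷_; lookupWith)
open import Data.List.Relation.Binary.Permutation.Propositional using (_↭_; ↭-sym; ↭-trans)
open import Data.List.Relation.Binary.Permutation.Propositional.Properties
  using (All-resp-↭; Any-resp-↭; filter-↭; ↭-length)
open import Data.Nat using (ℕ; zero; suc; _+_; _*_; _≤_)
open import Data.Nat.Divisibility using (_∣_; divides)
open import Data.Nat.ListAction using (sum)
open import Data.Nat.Properties
  using (+-identityʳ; *-comm; *-identityʳ; *-zeroʳ; *-distribˡ-+; +-commutativeSemigroup)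
open import Algebra.Properties.CommutativeSemigroup +-commutativeSemigroup
  using () renaming (interchange to +-interchange)
open import Data.Product using (_×_; _,_; proj₁; proj₂)
open import Function using (_∘_; id)
open import Relation.Nullary using (Dec; yes; no; ¬_)
open import Relation.Nullary.Decidable using (⌊_⌋; isYes≗does; dec-true; dec-false; ⌊⌋-map′)
open import Relation.Binary.PropositionalEquality

𝟙 : Bool → ℕ
𝟙 true  = 1
𝟙 false = 0

⌊⌋-true : ∀ {A : Set} (a? : Dec A) → A → ⌊ a? ⌋ ≡ true
⌊⌋-true a? a = trans (isYes≗does a?) (dec-true a? a)

⌊⌋-false : ∀ {A : Set} (a? : Dec A) → ¬ A → ⌊ a? ⌋ ≡ false
⌊⌋-false a? ¬a = trans (isYes≗does a?) (dec-false a? ¬a)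

⌊≟⌋-sym : ∀ {n} (a b : Fin n) → ⌊ a ≟ b ⌋ ≡ ⌊ b ≟ a ⌋
⌊≟⌋-sym a b with a ≟ b
... | yes a≡b = sym (⌊⌋-true (b ≟ a) (sym a≡b))
... | no  a≢b = sym (⌊⌋-false (b ≟ a) (a≢b ∘ sym))

𝟙-split : ∀ a c → 𝟙 (a ∧ not c) + 𝟙 (c ∧ a) ≡ 𝟙 a
𝟙-split true  true  = refl
𝟙-split true  false = refl
𝟙-split false true  = refl
𝟙-split false false = refl

module _ {A : Set} where

  length-filterᵇ-∷ : (P : A → Bool) (x : A) (xs : List A) →
                     length (filterᵇ P (x ∷ xs)) ≡ 𝟙 (P x) + length (filterᵇ P xs)
  length-filterᵇ-∷ P x xs with P x
  ... | true  = refl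
  ... | false = refl

  length-filterᵇ-↭ : (P : A → Bool) {xs ys : List A} → xs ↭ ys →
                     length (filterᵇ P xs) ≡ length (filterᵇ P ys)
  length-filterᵇ-↭ P xs↭ys = ↭-length (filter-↭ (T? ∘ P) xs↭ys)

  sum-map-+ : (f g : A → ℕ) (xs : List A) →
              sum (map (λ x → f x + g x) xs) ≡ sum (map f xs) + sum (map g xs)
  sum-map-+ f g []       = refl
  sum-map-+ f g (x ∷ xs) = trans (cong (f x + g x +_) (sum-map-+ f g xs))
                                 (+-interchange (f x) (g x) _ _)

  sum-map-cong : {f g : A → ℕ} → (∀ x → f x ≡ g x) → (xs : List A) → sum (map f xs) ≡ sum (map g xs)
  sum-map-cong f≗g xs = cong sum (map-cong f≗g xs)

  sum-map-zero : (f : A → ℕ) → (∀ x → f x ≡ 0) → (xs : List A) → sum (map f xs) ≡ 0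
  sum-map-zero f f≗0 []       = refl
  sum-map-zero f f≗0 (x ∷ xs) = cong₂ _+_ (f≗0 x) (sum-map-zero f f≗0 xs)

sum-allFin-suc : ∀ n (f : Fin (suc n) → ℕ) →
                 sum (map f (allFin (suc n))) ≡ f zero + sum (map (f ∘ suc) (allFin n))
sum-allFin-suc n f = cong (λ xs → f zero + sum xs)
  (trans (map-tabulate suc f) (sym (map-tabulate id (f ∘ suc))))

sum-𝟙-≟-∧ : ∀ n (r : Fin n) (B : Fin n → Bool) →
            sum (map (λ u → 𝟙 (⌊ r ≟ u ⌋ ∧ B u)) (allFin n)) ≡ 𝟙 (B r)
sum-𝟙-≟-∧ (suc n) zero B = begin
  sum (map (λ u → 𝟙 (⌊ zero ≟ u ⌋ ∧ B u)) (allFin (suc n)))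
    ≡⟨ sum-allFin-suc n (λ u → 𝟙 (⌊ zero ≟ u ⌋ ∧ B u)) ⟩
  𝟙 (B zero) + sum (map (λ _ → 0) (allFin n))
    ≡⟨ cong (𝟙 (B zero) +_) (sum-map-zero _ (λ _ → refl) (allFin n)) ⟩
  𝟙 (B zero) + 0
    ≡⟨ +-identityʳ _ ⟩
  𝟙 (B zero) ∎
  where open ≡-Reasoning
sum-𝟙-≟-∧ (suc n) (suc r) B = begin
  sum (map (λ u → 𝟙 (⌊ suc r ≟ u ⌋ ∧ B u)) (allFin (suc n)))
    ≡⟨ sum-allFin-suc n (λ u → 𝟙 (⌊ suc r ≟ u ⌋ ∧ B u)) ⟩
  sum (map (λ u → 𝟙 (⌊ suc r ≟ suc u ⌋ ∧ B (suc u))) (allFin n))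
    ≡⟨ sum-map-cong (λ u → cong (λ b → 𝟙 (b ∧ B (suc u))) (⌊⌋-map′ _ _ (r ≟ u))) (allFin n) ⟩
  sum (map (λ u → 𝟙 (⌊ r ≟ u ⌋ ∧ B (suc u))) (allFin n))
    ≡⟨ sum-𝟙-≟-∧ n r (B ∘ suc) ⟩
  𝟙 (B (suc r)) ∎
  where open ≡-Reasoning

sum-𝟙-∈?≡∣∣ : ∀ n (e : Subset n) → sum (map (λ v → 𝟙 ⌊ v ∈? e ⌋) (allFin n)) ≡ ∣ e ∣
sum-𝟙-∈?≡∣∣ zero    []      = refl
sum-𝟙-∈?≡∣∣ (suc n) (x ∷ e) = begin
  sum (map (λ v → 𝟙 ⌊ v ∈? (x ∷ e) ⌋) (allFin (suc n)))
    ≡⟨ sum-allFin-suc n (λ v → 𝟙 ⌊ v ∈? (x ∷ e) ⌋) ⟩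
  𝟙 ⌊ zero ∈? (x ∷ e) ⌋ + sum (map (λ v → 𝟙 ⌊ suc v ∈? (x ∷ e) ⌋) (allFin n))
    ≡⟨ cong (𝟙 ⌊ zero ∈? (x ∷ e) ⌋ +_)
         (sum-map-cong (λ v → cong 𝟙 (⌊⌋-map′ _ _ (v ∈? e))) (allFin n)) ⟩
  𝟙 ⌊ zero ∈? (x ∷ e) ⌋ + sum (map (λ v → 𝟙 ⌊ v ∈? e ⌋) (allFin n))
    ≡⟨ cong (𝟙 ⌊ zero ∈? (x ∷ e) ⌋ +_) (sum-𝟙-∈?≡∣∣ n e) ⟩
  𝟙 ⌊ zero ∈? (x ∷ e) ⌋ + ∣ e ∣
    ≡⟨ head-count x e ⟩
  ∣ x ∷ e ∣ ∎
  where
  open ≡-Reasoning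
  head-count : ∀ x (e : Subset n) → 𝟙 ⌊ zero ∈? (x ∷ e) ⌋ + ∣ e ∣ ≡ ∣ x ∷ e ∣
  head-count inside  e = refl
  head-count outside e = refl

sum-𝟙-∈?∧≢+1≡∣∣ : ∀ n (r : Fin n) (e : Subset n) → r ∈ e →
                  sum (map (λ v → 𝟙 (⌊ v ∈? e ⌋ ∧ not ⌊ v ≟ r ⌋)) (allFin n)) + 1 ≡ ∣ e ∣
sum-𝟙-∈?∧≢+1≡∣∣ n r e r∈e = begin
  sum (map (λ v → 𝟙 (⌊ v ∈? e ⌋ ∧ not ⌊ v ≟ r ⌋)) (allFin n)) + 1
    ≡⟨ cong (sum (map (λ v → 𝟙 (⌊ v ∈? e ⌋ ∧ not ⌊ v ≟ r ⌋)) (allFin n)) +_) (sym only-r) ⟩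
  sum (map (λ v → 𝟙 (⌊ v ∈? e ⌋ ∧ not ⌊ v ≟ r ⌋)) (allFin n))
    + sum (map (λ v → 𝟙 (⌊ v ≟ r ⌋ ∧ ⌊ v ∈? e ⌋)) (allFin n))
    ≡⟨ sym (sum-map-+ _ _ (allFin n)) ⟩
  sum (map (λ v → 𝟙 (⌊ v ∈? e ⌋ ∧ not ⌊ v ≟ r ⌋) + 𝟙 (⌊ v ≟ r ⌋ ∧ ⌊ v ∈? e ⌋)) (allFin n))
    ≡⟨ sum-map-cong (λ v → 𝟙-split ⌊ v ∈? e ⌋ ⌊ v ≟ r ⌋) (allFin n) ⟩
  sum (map (λ v → 𝟙 ⌊ v ∈? e ⌋) (allFin n))
    ≡⟨ sum-𝟙-∈?≡∣∣ n e ⟩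
  ∣ e ∣ ∎
  where
  open ≡-Reasoning
  only-r : sum (map (λ v → 𝟙 (⌊ v ≟ r ⌋ ∧ ⌊ v ∈? e ⌋)) (allFin n)) ≡ 1
  only-r = begin
    sum (map (λ v → 𝟙 (⌊ v ≟ r ⌋ ∧ ⌊ v ∈? e ⌋)) (allFin n))
      ≡⟨ sum-map-cong (λ v → cong (λ b → 𝟙 (b ∧ ⌊ v ∈? e ⌋)) (⌊≟⌋-sym v r)) (allFin n) ⟩
    sum (map (λ v → 𝟙 (⌊ r ≟ v ⌋ ∧ ⌊ v ∈? e ⌋)) (allFin n))
      ≡⟨ sum-𝟙-≟-∧ n r (λ v → ⌊ v ∈? e ⌋) ⟩
    𝟙 ⌊ r ∈? e ⌋
      ≡⟨ cong 𝟙 (⌊⌋-true (r ∈? e) r∈e) ⟩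
    1 ∎

module _ {n : ℕ} where

  starArc : Subset n → Fin n → Fin n → Fin n → ℕ
  starArc e r u v = 𝟙 (⌊ r ≟ u ⌋ ∧ (⌊ v ∈? e ⌋ ∧ not ⌊ v ≟ u ⌋))

  starInDeg starOutDeg : Subset n → Fin n → Fin n → ℕ
  starInDeg  e r w = sum (map (λ u → starArc e r u w) (allFin n))
  starOutDeg e r w = sum (map (starArc e r w) (allFin n))

  starInDeg+𝟙≡𝟙 : ∀ (e : Subset n) r w → r ∈ e → starInDeg e r w + 𝟙 ⌊ w ≟ r ⌋ ≡ 𝟙 ⌊ w ∈? e ⌋
  starInDeg+𝟙≡𝟙 e r w r∈e = begin
    starInDeg e r w + 𝟙 ⌊ w ≟ r ⌋
      ≡⟨ cong (_+ 𝟙 ⌊ w ≟ r ⌋) (sum-𝟙-≟-∧ n r (λ u → ⌊ w ∈? e ⌋ ∧ not ⌊ w ≟ u ⌋)) ⟩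
    𝟙 (⌊ w ∈? e ⌋ ∧ not ⌊ w ≟ r ⌋) + 𝟙 ⌊ w ≟ r ⌋
      ≡⟨ root-or-not ⟩
    𝟙 ⌊ w ∈? e ⌋ ∎
    where
    open ≡-Reasoning
    root-or-not : 𝟙 (⌊ w ∈? e ⌋ ∧ not ⌊ w ≟ r ⌋) + 𝟙 ⌊ w ≟ r ⌋ ≡ 𝟙 ⌊ w ∈? e ⌋
    root-or-not with w ≟ r
    ... | yes refl rewrite ⌊⌋-true (w ∈? e) r∈e = refl
    ... | no _ with ⌊ w ∈? e ⌋
    ...   | true  = refl
    ...   | false = refl

  starOutDeg+𝟙≡∣∣*𝟙 : ∀ (e : Subset n) r w → r ∈ e → starOutDeg e r w + 𝟙 ⌊ w ≟ r ⌋ ≡ ∣ e ∣ * 𝟙 ⌊ w ≟ r ⌋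
  starOutDeg+𝟙≡∣∣*𝟙 e r w r∈e = by-cases (r ≟ w)
    where
    open ≡-Reasoning
    by-cases : Dec (r ≡ w) → starOutDeg e r w + 𝟙 ⌊ w ≟ r ⌋ ≡ ∣ e ∣ * 𝟙 ⌊ w ≟ r ⌋
    by-cases (yes refl) = begin
      starOutDeg e r r + 𝟙 ⌊ r ≟ r ⌋
        ≡⟨ cong₂ _+_ (sum-map-cong (λ v → cong (λ b → 𝟙 (b ∧ (⌊ v ∈? e ⌋ ∧ not ⌊ v ≟ r ⌋))) r≟r) (allFin n)) (cong 𝟙 r≟r) ⟩
      sum (map (λ v → 𝟙 (⌊ v ∈? e ⌋ ∧ not ⌊ v ≟ r ⌋)) (allFin n)) + 1
        ≡⟨ sum-𝟙-∈?∧≢+1≡∣∣ n r e r∈e ⟩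
      ∣ e ∣
        ≡⟨ sym (*-identityʳ ∣ e ∣) ⟩
      ∣ e ∣ * 1
        ≡⟨ cong (λ b → ∣ e ∣ * 𝟙 b) (sym r≟r) ⟩
      ∣ e ∣ * 𝟙 ⌊ r ≟ r ⌋ ∎
      where
      r≟r : ⌊ r ≟ r ⌋ ≡ true
      r≟r = ⌊⌋-true (r ≟ r) refl
    by-cases (no r≢w) = begin
      starOutDeg e r w + 𝟙 ⌊ w ≟ r ⌋
        ≡⟨ cong₂ _+_ (sum-map-zero _ (λ v → cong (λ b → 𝟙 (b ∧ (⌊ v ∈? e ⌋ ∧ not ⌊ v ≟ w ⌋))) (⌊⌋-false (r ≟ w) r≢w)) (allFin n))
                     (cong 𝟙 w≟r) ⟩
      0
        ≡⟨ sym (*-zeroʳ ∣ e ∣) ⟩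
      ∣ e ∣ * 0
        ≡⟨ cong (λ b → ∣ e ∣ * 𝟙 b) (sym w≟r) ⟩
      ∣ e ∣ * 𝟙 ⌊ w ≟ r ⌋ ∎
      where
      w≟r : ⌊ w ≟ r ⌋ ≡ false
      w≟r = ⌊⌋-false (w ≟ r) (r≢w ∘ sym)

module _ {n : ℕ} where

  RootsInEdges : RootSeq n → Set
  RootsInEdges R = All (λ p → proj₂ p ∈ proj₁ p) R

  rootCount : RootSeq n → Fin n → ℕ
  rootCount R w = length (filterᵇ (λ p → ⌊ w ≟ proj₂ p ⌋) R)

  incidence : List (Subset n) → Fin n → ℕ
  incidence es w = length (filterᵇ (λ e → ⌊ w ∈? e ⌋) es)

  rootCount-∷ : ∀ (e : Subset n) r R w → rootCount ((e , r) ∷ R) w ≡ 𝟙 ⌊ w ≟ r ⌋ + rootCount R w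
  rootCount-∷ e r R w = length-filterᵇ-∷ (λ p → ⌊ w ≟ proj₂ p ⌋) (e , r) R

  incidence-∷ : ∀ (e : Subset n) es w → incidence (e ∷ es) w ≡ 𝟙 ⌊ w ∈? e ⌋ + incidence es w
  incidence-∷ e es w = length-filterᵇ-∷ (λ e → ⌊ w ∈? e ⌋) e es

  arcMult-∷ : ∀ (e : Subset n) r R u v → arcMult ((e , r) ∷ R) u v ≡ starArc e r u v + arcMult R u v
  arcMult-∷ e r R u v =
    length-filterᵇ-∷ (λ p → ⌊ proj₂ p ≟ u ⌋ ∧ (⌊ v ∈? proj₁ p ⌋ ∧ not ⌊ v ≟ u ⌋)) (e , r) R

  inDeg-∷ : ∀ (e : Subset n) r R w → inDeg ((e , r) ∷ R) w ≡ starInDeg e r w + inDeg R w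
  inDeg-∷ e r R w = trans (sum-map-cong (λ u → arcMult-∷ e r R u w) (allFin n))
                          (sum-map-+ (λ u → starArc e r u w) (λ u → arcMult R u w) (allFin n))

  outDeg-∷ : ∀ (e : Subset n) r R w → outDeg ((e , r) ∷ R) w ≡ starOutDeg e r w + outDeg R w
  outDeg-∷ e r R w = trans (sum-map-cong (arcMult-∷ e r R w) (allFin n))
                           (sum-map-+ (starArc e r w) (arcMult R w) (allFin n))

  inDeg+rootCount≡incidence : ∀ R w → RootsInEdges R →
                              inDeg R w + rootCount R w ≡ incidence (map proj₁ R) w
  inDeg+rootCount≡incidence [] w [] = cong (_+ 0) (sum-map-zero _ (λ _ → refl) (allFin n))
  inDeg+rootCount≡incidence ((e , r) ∷ R) w (r∈e ∷ rooted) = begin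
    inDeg ((e , r) ∷ R) w + rootCount ((e , r) ∷ R) w
      ≡⟨ cong₂ _+_ (inDeg-∷ e r R w) (rootCount-∷ e r R w) ⟩
    (starInDeg e r w + inDeg R w) + (𝟙 ⌊ w ≟ r ⌋ + rootCount R w)
      ≡⟨ +-interchange (starInDeg e r w) (inDeg R w) (𝟙 ⌊ w ≟ r ⌋) (rootCount R w) ⟩
    (starInDeg e r w + 𝟙 ⌊ w ≟ r ⌋) + (inDeg R w + rootCount R w)
      ≡⟨ cong₂ _+_ (starInDeg+𝟙≡𝟙 e r w r∈e) (inDeg+rootCount≡incidence R w rooted) ⟩
    𝟙 ⌊ w ∈? e ⌋ + incidence (map proj₁ R) w
      ≡⟨ sym (incidence-∷ e (map proj₁ R) w) ⟩
    incidence (map proj₁ ((e , r) ∷ R)) w ∎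
    where open ≡-Reasoning

  outDeg+rootCount≡k*rootCount : ∀ k R w → RootsInEdges R → All (λ e → ∣ e ∣ ≡ k) (map proj₁ R) →
                                 outDeg R w + rootCount R w ≡ k * rootCount R w
  outDeg+rootCount≡k*rootCount k [] w [] [] =
    trans (cong (_+ 0) (sum-map-zero _ (λ _ → refl) (allFin n))) (sym (*-zeroʳ k))
  outDeg+rootCount≡k*rootCount k ((e , r) ∷ R) w (r∈e ∷ rooted) (∣e∣≡k ∷ uniform) = begin
    outDeg ((e , r) ∷ R) w + rootCount ((e , r) ∷ R) w
      ≡⟨ cong₂ _+_ (outDeg-∷ e r R w) (rootCount-∷ e r R w) ⟩
    (starOutDeg e r w + outDeg R w) + (𝟙 ⌊ w ≟ r ⌋ + rootCount R w)
      ≡⟨ +-interchange (starOutDeg e r w) (outDeg R w) (𝟙 ⌊ w ≟ r ⌋) (rootCount R w) ⟩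
    (starOutDeg e r w + 𝟙 ⌊ w ≟ r ⌋) + (outDeg R w + rootCount R w)
      ≡⟨ cong₂ _+_ (starOutDeg+𝟙≡∣∣*𝟙 e r w r∈e) (outDeg+rootCount≡k*rootCount k R w rooted uniform) ⟩
    ∣ e ∣ * 𝟙 ⌊ w ≟ r ⌋ + k * rootCount R w
      ≡⟨ cong (λ m → m * 𝟙 ⌊ w ≟ r ⌋ + k * rootCount R w) ∣e∣≡k ⟩
    k * 𝟙 ⌊ w ≟ r ⌋ + k * rootCount R w
      ≡⟨ sym (*-distribˡ-+ k _ _) ⟩
    k * (𝟙 ⌊ w ≟ r ⌋ + rootCount R w)
      ≡⟨ cong (k *_) (sym (rootCount-∷ e r R w)) ⟩
    k * rootCount ((e , r) ∷ R) w ∎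
    where open ≡-Reasoning

V⊆V-of-↭ : ∀ {n} (H H' : MultiHypergraph n) → NoIsolatedVertices H → E H ↭ E H' → V H ⊆ V H'
V⊆V-of-↭ H H' noIsolated E↭E' {x} x∈V =
  lookupWith (λ e⊆V x∈e → e⊆V x∈e) (E⊆V H') (Any-resp-↭ E↭E' (noIsolated x x∈V))

lemma3 : (k n : ℕ) → 2 ≤ k → (H : MultiHypergraph n) → Uniform k H
    → NoIsolatedVertices H → (R : RootSeq n) → IsEulerRooting H R
    → Veblen k H
      × ((H' : MultiHypergraph n) → NoIsolatedVertices H' → IsRooting H' R
         → SameHypergraph H H')
lemma3 k n _ H uniform noIsolated R ((R↭E , rooted , _) , (_ , balanced)) =
  (uniform , k∣degree) , unique
  where
  k∣degree : ∀ v → v ∈ V H → k ∣ degree H v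
  k∣degree v _ = divides (rootCount R v) (begin
    degree H v                     ≡⟨ length-filterᵇ-↭ _ (↭-sym R↭E) ⟩
    incidence (map proj₁ R) v      ≡⟨ sym (inDeg+rootCount≡incidence R v rooted) ⟩
    inDeg R v + rootCount R v      ≡⟨ cong (_+ rootCount R v) (balanced v) ⟩
    outDeg R v + rootCount R v     ≡⟨ outDeg+rootCount≡k*rootCount k R v rooted
                                        (All-resp-↭ (↭-sym R↭E) uniform) ⟩
    k * rootCount R v              ≡⟨ *-comm k _ ⟩
    rootCount R v * k              ∎)
    where open ≡-Reasoning
  unique : (H' : MultiHypergraph n) → NoIsolatedVertices H' → IsRooting H' R → SameHypergraph H H'
  unique H' noIsolated' (R↭E' , _) =
    ⊆-antisym (V⊆V-of-↭ H H' noIsolated E↭E') (V⊆V-of-↭ H' H noIsolated' (↭-sym E↭E')) , E↭E'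
    where E↭E' = ↭-trans (↭-sym R↭E) R↭E'
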